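{- Let $G=\boxtimes_{i=1}^nG_i$ be a strong product graph and let $H=\boxtimes_{i=1}^nH_i\subseteq G$ be a subproduct, where each $H_i$ is an induced subgraph of $G_i$. Let $x\in V(H)$ have coordinates $(x_1,\dots,x_n)$. Then \[S_H(x)=\times_{i=1}^nS_{H_i}(x_i),\] where $S_{H_i}(x_i)$ is taken with respect to $H_i\subseteq G_i$. Consequently, $|S_H(x)|=\prod_{i=1}^n|S_{H_i}(x_i)|$.
   Context: All graphs are finite, simple, undirected. $N^G[v]$ is the closed neighborhood of $v$ in $G$. The strong product $\boxtimes_i G_i$ has vertex set $\times_iV(G_i)$; distinct vertices are adjacent iff in each coordinate they are equal or adjacent. A subproduct is a subgraph $\boxtimes_iH_i$ with $H_i\subseteq G_i$. For an induced subgraph $H$ of a graph $G$ and $x\in V(H)$, $S_H(x)=\{v\in V(H): N^G[v]\cap V(H)=N^G[x]\cap V(H)\}$. -}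

module Defs where

open import Data.Nat using (ℕ; zero; suc; _*_)
open import Data.Fin using (Fin; zero; suc)
open import Data.Bool using (Bool; true; false)
open import Data.Unit using (⊤; tt)
open import Data.Product using (_×_; _,_; proj₁; proj₂; Σ)
open import Data.Sum using (_⊎_)
open import Data.List using (List; length)
open import Data.List.Relation.Unary.Unique.Propositional using (Unique)
open import Data.List.Membership.Propositional using () renaming (_∈_ to _∈ˡ_)
open import Relation.Binary.PropositionalEquality using (_≡_; _≢_)
open import Relation.Nullary using (¬_)
open import Function.Bundles using (_⇔_)

record Graph : Set where
  field
    size       : ℕ
    adj        : Fin size → Fin size → Bool
    adj-sym    : ∀ u v → adj u v ≡ adj v u
    adj-irrefl : ∀ v → adj v v ≡ false

  Adj : Fin size → Fin size → Set
  Adj u v = adj u v ≡ true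

open Graph public

ClosedNbr : {V : Set} → (V → V → Set) → V → V → Set
ClosedNbr Adj' v w = (w ≡ v) ⊎ Adj' v w

-- v ∈ S_H(x), where H is the induced subgraph with vertex set InH:
-- v ∈ V(H) and N[v] ∩ V(H) = N[x] ∩ V(H).
InS : {V : Set} → (V → V → Set) → (V → Set) → V → V → Set
InS Adj' InH x v =
  InH v × (∀ w → InH w → (ClosedNbr Adj' v w ⇔ ClosedNbr Adj' x w))

Card : {V : Set} → (V → Set) → ℕ → Set
Card {V} P k = Σ (List V) λ l →
  Unique l × (∀ v → (v ∈ˡ l) ⇔ P v) × (length l ≡ k)

Tuple : (n : ℕ) → (Fin n → ℕ) → Set
Tuple zero    m = ⊤
Tuple (suc n) m = Fin (m zero) × Tuple n (λ i → m (suc i))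

coord : {n : ℕ} {m : Fin n → ℕ} → Tuple n m → (i : Fin n) → Fin (m i)
coord {suc n} (a , _) zero    = a
coord {suc n} (_ , t) (suc i) = coord t i

sizes : {n : ℕ} → (Fin n → Graph) → Fin n → ℕ
sizes G i = size (G i)

SPVertex : {n : ℕ} → (Fin n → Graph) → Set
SPVertex {n} G = Tuple n (sizes G)

SPAdj : {n : ℕ} (G : Fin n → Graph) → SPVertex G → SPVertex G → Set
SPAdj G u v = (u ≢ v) ×
  (∀ i → (coord u i ≡ coord v i) ⊎ Adj (G i) (coord u i) (coord v i))

-- Vertex set of the subproduct ⊠ Hᵢ, where Hᵢ is given by its vertex set.
InSubproduct : {n : ℕ} (G : Fin n → Graph) →
               ((i : Fin n) → Fin (size (G i)) → Set) → SPVertex G → Set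
InSubproduct G H v = ∀ i → H i (coord v i)

∏ : (n : ℕ) → (Fin n → ℕ) → ℕ
∏ zero    k = 1
∏ (suc n) k = k zero * ∏ n (λ i → k (suc i))

-- In the strong product, w ∈ N[v] iff wᵢ ∈ N[vᵢ] for every i.  So the inclusion
-- N[v] ∩ V(H) ⊆ N[x] ∩ V(H) can be tested on tuples differing from v in a single
-- coordinate, which stay in V(H) because H is a box; this splits v ∈ S_H(x) into the
-- conditions vᵢ ∈ S_{Hᵢ}(xᵢ).  Hence S_H(x) is itself a box, and the size of a box is
-- the product of the sizes of its sides.
module Submission where

open import Defs
open import Data.Nat using (ℕ; zero; suc; _*_; _+_)
open import Data.Fin using (Fin; zero; suc)
import Data.Fin.Properties as Fin
open import Data.Product using (_×_; _,_; proj₁; proj₂)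
open import Data.Product.Properties using (≡-dec)
open import Data.Sum using (inj₁; inj₂; map₁)
open import Data.Unit using (tt)
import Data.Unit.Properties as Unit
open import Data.List using (List; []; _∷_; _++_; length; map; cartesianProduct)
open import Data.List.Properties using (length-++; length-map)
open import Data.List.Relation.Unary.Any using (here)
open import Data.List.Relation.Unary.All using ([])
open import Data.List.Relation.Unary.Unique.Propositional using ([]; _∷_)
open import Data.List.Relation.Unary.Unique.Propositional.Properties
  using (cartesianProduct⁺)
open import Data.List.Membership.Propositional.Properties
  using (∈-cartesianProduct⁺; ∈-cartesianProduct⁻)
open import Relation.Binary.Definitions using (DecidableEquality; Reflexive)
open import Relation.Binary.PropositionalEquality
  using (_≡_; refl; sym; cong₂; subst; module ≡-Reasoning)
open import Relation.Nullary using (yes; no)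
open import Function.Bundles using (_⇔_; mk⇔; Equivalence)
import Function.Properties.Equivalence as ⇔
open Equivalence

module _ {n : ℕ} {m : Fin n → ℕ} where

  Box : ((i : Fin n) → Fin (m i) → Set) → Tuple n m → Set
  Box P t = ∀ i → P i (coord t i)

  Pointwise : ((i : Fin n) → Fin (m i) → Fin (m i) → Set) →
              Tuple n m → Tuple n m → Set
  Pointwise R u w = ∀ i → R i (coord u i) (coord w i)

tuple-≟ : ∀ {n} {m : Fin n → ℕ} → DecidableEquality (Tuple n m)
tuple-≟ {zero}  = Unit._≟_
tuple-≟ {suc n} = ≡-dec Fin._≟_ tuple-≟

update : ∀ {n} {m : Fin n → ℕ} → Tuple n m → (i : Fin n) → Fin (m i) → Tuple n m
update (_ , t) zero    b = b , t
update (a , t) (suc i) b = a , update t i b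

coord-update-≡ : ∀ {n} {m : Fin n → ℕ} (t : Tuple n m) i b →
                 coord (update t i b) i ≡ b
coord-update-≡ (_ , _) zero    b = refl
coord-update-≡ (_ , t) (suc i) b = coord-update-≡ t i b

update-Box : ∀ {n} {m : Fin n → ℕ} (P : (i : Fin n) → Fin (m i) → Set)
             (t : Tuple n m) i {b} → P i b → Box P t → Box P (update t i b)
update-Box P (_ , _) zero    pb pt zero    = pb
update-Box P (_ , _) zero    pb pt (suc j) = pt (suc j)
update-Box P (_ , _) (suc i) pb pt zero    = pt zero
update-Box P (_ , t) (suc i) pb pt (suc j) =
  update-Box (λ j → P (suc j)) t i pb (λ j → pt (suc j)) j

Box-,⇔ : ∀ {n} {m : Fin (suc n) → ℕ} (P : (i : Fin (suc n)) → Fin (m i) → Set) a t →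
         Box P (a , t) ⇔ (P zero a × Box (λ i → P (suc i)) t)
Box-,⇔ P a t = mk⇔ (λ p → p zero , λ i → p (suc i))
                   (λ { (p₀ , _) zero → p₀ ; (_ , p) (suc i) → p i })

module _ {n : ℕ} {m : Fin n → ℕ}
         (R S : (i : Fin n) → Fin (m i) → Fin (m i) → Set)
         (R-refl : ∀ i → Reflexive (R i)) where

  -- Test the implication on w = u with the i-th coordinate replaced by a.
  Pointwise⇒-on-Box⇒coordinate : ∀ {P : (i : Fin n) → Fin (m i) → Set} {u u'} →
    Box P u → (∀ w → Box P w → Pointwise R u w → Pointwise S u' w) →
    ∀ i {a} → P i a → R i (coord u i) a → S i (coord u' i) a
  Pointwise⇒-on-Box⇒coordinate {P} {u} {u'} pu R⇒S i {a} pa r =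
    subst (S i (coord u' i)) (coord-update-≡ u i a) (R⇒S w pw Ruw i)
    where
    w = update u i a
    pw : Box P w
    pw = update-Box P u i pa pu
    Ruw : Pointwise R u w
    Ruw = update-Box (λ j → R j (coord u j)) u i r (λ j → R-refl j)

module _ {n : ℕ} {m : Fin n → ℕ} (Adj' : Tuple n m → Tuple n m → Set)
         (A : (i : Fin n) → Fin (m i) → Fin (m i) → Set)
         (ClosedNbr⇔ : ∀ v w → ClosedNbr Adj' v w
                              ⇔ Pointwise (λ i → ClosedNbr (A i)) v w)
         (H : (i : Fin n) → Fin (m i) → Set) {x : Tuple n m} (x∈H : Box H x) where

  InS-Box⇔ : ∀ v → InS Adj' (Box H) x v ⇔ Box (λ i → InS (A i) (H i) (coord x i)) v
  InS-Box⇔ v = mk⇔ split join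
    where
    coordinate : ∀ {u u'} → Box H u →
      (∀ w → Box H w → Pointwise (λ i → ClosedNbr (A i)) u w
                     → Pointwise (λ i → ClosedNbr (A i)) u' w) →
      ∀ i {a} → H i a → ClosedNbr (A i) (coord u i) a → ClosedNbr (A i) (coord u' i) a
    coordinate = Pointwise⇒-on-Box⇒coordinate
      (λ i → ClosedNbr (A i)) (λ i → ClosedNbr (A i)) (λ i → inj₁ refl)

    split : InS Adj' (Box H) x v → Box (λ i → InS (A i) (H i) (coord x i)) v
    split (v∈H , N[v]≈N[x]) i = v∈H i , λ a a∈Hᵢ → mk⇔
      (coordinate v∈H (λ w w∈H Nvw → to (ClosedNbr⇔ x w)
                         (to (N[v]≈N[x] w w∈H) (from (ClosedNbr⇔ v w) Nvw))) i a∈Hᵢ)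
      (coordinate x∈H (λ w w∈H Nxw → to (ClosedNbr⇔ v w)
                         (from (N[v]≈N[x] w w∈H) (from (ClosedNbr⇔ x w) Nxw))) i a∈Hᵢ)

    join : Box (λ i → InS (A i) (H i) (coord x i)) v → InS Adj' (Box H) x v
    join s = (λ i → proj₁ (s i)) , λ w w∈H → mk⇔
      (λ Nvw → from (ClosedNbr⇔ x w) λ i →
         to (proj₂ (s i) (coord w i) (w∈H i)) (to (ClosedNbr⇔ v w) Nvw i))
      (λ Nxw → from (ClosedNbr⇔ v w) λ i →
         from (proj₂ (s i) (coord w i) (w∈H i)) (to (ClosedNbr⇔ x w) Nxw i))

ClosedNbr-SPAdj⇔ : ∀ {n} (G : Fin n → Graph) (v w : SPVertex G) →
  ClosedNbr (SPAdj G) v w ⇔ Pointwise (λ i → ClosedNbr (Adj (G i))) v w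
ClosedNbr-SPAdj⇔ G v w = mk⇔ split join
  where
  split : ClosedNbr (SPAdj G) v w → Pointwise (λ i → ClosedNbr (Adj (G i))) v w
  split (inj₁ refl)       i = inj₁ refl
  split (inj₂ (_ , v~w)) i = map₁ sym (v~w i)

  join : Pointwise (λ i → ClosedNbr (Adj (G i))) v w → ClosedNbr (SPAdj G) v w
  join N with tuple-≟ w v
  ... | yes w≡v = inj₁ w≡v
  ... | no  w≢v = inj₂ ((λ v≡w → w≢v (sym v≡w)) , λ i → map₁ sym (N i))

length-cartesianProduct : ∀ {A B : Set} (xs : List A) (ys : List B) →
  length (cartesianProduct xs ys) ≡ length xs * length ys
length-cartesianProduct []       ys = refl
length-cartesianProduct (x ∷ xs) ys = begin
  length (map (x ,_) ys ++ cartesianProduct xs ys)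
    ≡⟨ length-++ (map (x ,_) ys) ⟩
  length (map (x ,_) ys) + length (cartesianProduct xs ys)
    ≡⟨ cong₂ _+_ (length-map (x ,_) ys) (length-cartesianProduct xs ys) ⟩
  length ys + length xs * length ys ∎
  where open ≡-Reasoning

Card-⇔ : ∀ {V : Set} {P Q : V → Set} {k} → (∀ v → P v ⇔ Q v) → Card P k → Card Q k
Card-⇔ P⇔Q (l , unique , l≈P , len) =
  l , unique , (λ v → ⇔.trans (l≈P v) (P⇔Q v)) , len

Card-× : ∀ {A B : Set} {P : A → Set} {Q : B → Set} {k l} →
  Card P k → Card Q l → Card (λ ab → P (proj₁ ab) × Q (proj₂ ab)) (k * l)
Card-× (xs , xs! , xs≈P , refl) (ys , ys! , ys≈Q , refl) =
  cartesianProduct xs ys , cartesianProduct⁺ xs! ys! ,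
  (λ { (a , b) → mk⇔
    (λ ab∈ → let a∈ , b∈ = ∈-cartesianProduct⁻ xs ys ab∈
             in to (xs≈P a) a∈ , to (ys≈Q b) b∈)
    (λ { (pa , qb) → ∈-cartesianProduct⁺ (from (xs≈P a) pa) (from (ys≈Q b) qb) }) }) ,
  length-cartesianProduct xs ys

Card-Box : ∀ n {m : Fin n → ℕ} {P : (i : Fin n) → Fin (m i) → Set} {k : Fin n → ℕ} →
  (∀ i → Card (P i) (k i)) → Card (Box P) (∏ n k)
Card-Box zero    _ = tt ∷ [] , [] ∷ [] , (λ _ → mk⇔ (λ _ ()) (λ _ → here refl)) , refl
Card-Box (suc n) {P = P} c =
  Card-⇔ (λ { (a , t) → ⇔.sym (Box-,⇔ P a t) })
         (Card-× (c zero) (Card-Box n (λ i → c (suc i))))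

corollary3p12 : (n : ℕ) (G : Fin n → Graph)
    (H : (i : Fin n) → Fin (size (G i)) → Set)
    (x : SPVertex G) → InSubproduct G H x →
    ((v : SPVertex G) →
    InS (SPAdj G) (InSubproduct G H) x v
    ⇔ ((i : Fin n) → InS (Adj (G i)) (H i) (coord x i) (coord v i)))
    × ((k : Fin n → ℕ) →
    ((i : Fin n) → Card (InS (Adj (G i)) (H i) (coord x i)) (k i)) →
    Card (InS (SPAdj G) (InSubproduct G H) x) (∏ n k))
corollary3p12 n G H x x∈H = S-product , λ k cards →
  Card-⇔ (λ v → ⇔.sym (S-product v)) (Card-Box n cards)
  where
  S-product : (v : SPVertex G) → InS (SPAdj G) (InSubproduct G H) x v
              ⇔ ((i : Fin n) → InS (Adj (G i)) (H i) (coord x i) (coord v i))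
  S-product = InS-Box⇔ (SPAdj G) (λ i → Adj (G i)) (ClosedNbr-SPAdj⇔ G) H x∈H
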